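{- Let $A$ be a deterministic assignment problem (an $m\times n$ matrix of nonnegative reals and an integer $k\le\min(m,n)$). Let $\mu$ be an optimal $k$-assignment, and let $a$ be a matrix position not belonging to $\mu$. Suppose that there is another optimal $k$-assignment $\nu$ containing $a$. Then there is an optimal $k$-assignment $\nu'$ containing $a$ such that $\mu\triangle\nu'$ consists either of one path, or of two paths each of odd length.
   Context: A $k$-assignment is a set of $k$ matrix positions, no two in the same row or column; its cost is the sum of the entries there, and it is optimal if its cost is minimal among all $k$-assignments. For two $k$-assignments $\mu,\nu$, $\mu\triangle\nu=(\mu\setminus\nu)\cup(\nu\setminus\mu)$. Consider the graph on the positions of $\mu\triangle\nu$ in which two positions are adjacent if they lie in the same row or the same column; each connected component is a $(\mu,\nu)$-alternating sequence of positions (positions of $\mu$ alternating with positions of $\nu$, consecutive ones sharing a row or column), called a path of $\mu\triangle\nu$; its length is the number of positions in it. -}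

module Defs where

open import Level using (Level; suc; _⊔_)
open import Data.Nat using (ℕ; _*_; _%_) renaming (suc to sucℕ)
open import Data.Fin using (Fin; zero) renaming (suc to fsuc)
open import Data.Product using (Σ; ∃; ∃-syntax; _×_; _,_; proj₁; proj₂)
open import Data.Sum using (_⊎_)
open import Data.List using (List; length)
open import Data.List.Membership.Propositional using (_∈_)
open import Data.List.Relation.Unary.Unique.Propositional using (Unique)
open import Relation.Nullary using (¬_)
open import Relation.Binary.PropositionalEquality using (_≡_)
open import Relation.Binary.Structures using (IsTotalOrder)
open import Relation.Binary.Construct.Closure.ReflexiveTransitive using (Star)
open import Algebra.Structures using (IsAbelianGroup)

-- Matrix entries: the paper uses nonnegative reals.  agda-stdlib has no reals,
-- so we work over an arbitrary totally ordered abelian group (ℝ is an instance).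
record OrderedAbelianGroup (c ℓ : Level) : Set (suc (c ⊔ ℓ)) where
  infixl 6 _+_
  infix 4 _≤_
  field
    Carrier        : Set c
    _+_            : Carrier → Carrier → Carrier
    0#             : Carrier
    -_             : Carrier → Carrier
    _≤_            : Carrier → Carrier → Set ℓ
    isAbelianGroup : IsAbelianGroup _≡_ _+_ 0# -_
    isTotalOrder   : IsTotalOrder _≡_ _≤_
    +-monoˡ-≤      : ∀ a b c → a ≤ b → a + c ≤ b + c

Pos : ℕ → ℕ → Set
Pos m n = Fin m × Fin n

row : ∀ {m n} → Pos m n → Fin m
row = proj₁

col : ∀ {m n} → Pos m n → Fin n
col = proj₂

-- A k-assignment: k positions, no two in the same row or column
-- (enumerated by Fin k; distinct rows ⇒ distinct positions).
record Assignment (m n k : ℕ) : Set where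
  field
    pos      : Fin k → Pos m n
    rowInj   : ∀ i j → row (pos i) ≡ row (pos j) → i ≡ j
    colInj   : ∀ i j → col (pos i) ≡ col (pos j) → i ≡ j
open Assignment public

_∈ₐ_ : ∀ {m n k} → Pos m n → Assignment m n k → Set
p ∈ₐ μ = ∃[ i ] pos μ i ≡ p

_∈△_,_ : ∀ {m n k} → Pos m n → Assignment m n k → Assignment m n k → Set
p ∈△ μ , ν = (p ∈ₐ μ × ¬ (p ∈ₐ ν)) ⊎ (p ∈ₐ ν × ¬ (p ∈ₐ μ))

module Costs {c ℓ} (G : OrderedAbelianGroup c ℓ) where
  open OrderedAbelianGroup G

  sumFin : ∀ {k} → (Fin k → Carrier) → Carrier
  sumFin {ℕ.zero}  f = 0#
  sumFin {sucℕ k} f = f zero + sumFin (λ i → f (fsuc i))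

  cost : ∀ {m n k} → (Fin m → Fin n → Carrier) → Assignment m n k → Carrier
  cost A μ = sumFin (λ i → A (row (pos μ i)) (col (pos μ i)))

  Optimal : ∀ {m n k} → (Fin m → Fin n → Carrier) → Assignment m n k → Set ℓ
  Optimal {m} {n} {k} A μ = (ρ : Assignment m n k) → cost A μ ≤ cost A ρ

Adj : ∀ {m n} → Pos m n → Pos m n → Set
Adj p q = row p ≡ row q ⊎ col p ≡ col q

AdjIn : ∀ {m n} → (Pos m n → Set) → Pos m n → Pos m n → Set
AdjIn S p q = S p × S q × Adj p q

Reach : ∀ {m n} → (Pos m n → Set) → Pos m n → Pos m n → Set
Reach S = Star (AdjIn S)

-- C (a duplicate-free list) is exactly a connected component of the graph on S;
-- its length is the number of positions in that path.
IsComponent : ∀ {m n} → (Pos m n → Set) → List (Pos m n) → Set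
IsComponent S C =
  Unique C × ∃[ r ] (∀ q → (q ∈ C → S r × Reach S r q) × (S r × Reach S r q → q ∈ C))

Odd : ℕ → Set
Odd t = ∃[ j ] t ≡ sucℕ (2 * j)

OnePath : ∀ {m n} → (Pos m n → Set) → Set
OnePath S = ∃[ C ] IsComponent S C × (∀ q → S q → q ∈ C)

TwoOddPaths : ∀ {m n} → (Pos m n → Set) → Set
TwoOddPaths S = ∃[ C₁ ] ∃[ C₂ ]
    IsComponent S C₁ × IsComponent S C₂
  × (∀ q → q ∈ C₁ → q ∈ C₂ → ⊥')
  × (∀ q → S q → q ∈ C₁ ⊎ q ∈ C₂)
  × Odd (length C₁) × Odd (length C₂)
  where open import Data.Empty renaming (⊥ to ⊥')

NonNeg : ∀ {c ℓ} (G : OrderedAbelianGroup c ℓ) {m n : ℕ} →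
         (Fin m → Fin n → OrderedAbelianGroup.Carrier G) → Set ℓ
NonNeg G A = ∀ i j → OrderedAbelianGroup._≤_ G (OrderedAbelianGroup.0# G) (A i j)

{-# OPTIONS --safe #-}

-- Every position of μ △ ν has at most one other position of μ △ ν in its row and at most one
-- in its column, and these alternate between μ and ν. So "row mate" and "column mate" are two
-- involutions of μ △ ν, and the components of μ △ ν are their orbits: alternating paths and
-- cycles. Walking from a position in both directions shows that an orbit has as many positions
-- of μ as of ν, or exactly one more of one of them, and then it has odd length.
--
-- Replacing μ by ν on a union D of orbits with as many positions of μ as of ν gives a
-- k-assignment; doing the same with μ and ν swapped gives another one, and the two costs add
-- up to cost μ + cost ν, so both are optimal. If the orbit P of a is balanced, exchanging μ
-- along P gives ν′. Otherwise P has a surplus of, say, ν, so some ν-position of P has no row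
-- mate (else row mates would inject the ν-positions of P into its μ-positions): its row holds
-- no position of μ. As μ and ν occupy k rows each, some position y of μ has no position of ν
-- in its row; the orbit Q of y starts at y, so it is balanced or has a surplus of μ. In the
-- second case exchanging μ along P ∪ Q gives ν′. In the first, exchanging ν along Q keeps ν
-- optimal and containing a but shrinks μ △ ν, and we recurse.

module Submission where

open import Defs
open import Level using (0ℓ)
open import Algebra.Bundles using (CommutativeSemigroup)
open import Algebra.Structures using (IsAbelianGroup)
open import Data.Bool as Bool using (Bool; true; false; not)
open import Data.Bool.Properties using (not-involutive; ¬-not)
open import Data.Empty using (⊥; ⊥-elim)
open import Data.Fin as Fin using (Fin; zero; suc; punchOut)
import Data.Fin.Properties as Finₚ
open import Data.List using (List; []; _∷_; [_]; _++_; length; filter; map; tabulate; lookup; foldr; cartesianProduct; allFin)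
open import Data.List.Properties
  using (length-++; length-tabulate; tabulate-lookup; filter-++; length-filter; length-map; ++-assoc)
open import Data.List.Membership.Propositional using (_∈_; _∉_; find; lose)
open import Data.List.Membership.Propositional.Properties
  using (∈-filter⁺; ∈-filter⁻; ∈-map⁻; ∈-++⁺ˡ; ∈-++⁺ʳ; ∈-++⁻; ∈-tabulate⁺; ∈-tabulate⁻; ∈-lookup;
         ∈-cartesianProduct⁺; ∈-allFin)
open import Data.List.Membership.Propositional.Properties.WithK using (unique∧set⇒bag)
open import Data.List.Relation.Binary.BagAndSetEquality using (∼bag⇒↭)
open import Data.List.Relation.Binary.Permutation.Propositional.Properties using (↭-length)
open import Data.List.Relation.Binary.Subset.Propositional using (_⊆_)
open import Data.List.Relation.Unary.All as All using (All; [])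
open import Data.List.Relation.Unary.All.Properties using (¬Any⇒All¬)
open import Data.List.Relation.Unary.Any using (here; there; any?; satisfied; index)
open import Data.List.Relation.Unary.Any.Properties using (lookup-index)
open import Data.List.Relation.Unary.Unique.Propositional using (Unique; []; _∷_)
import Data.List.Relation.Unary.Unique.Propositional.Properties as Unique
open import Data.Nat using (ℕ; zero; suc; _⊓_) renaming (_≤_ to _≤ℕ_)
open import Data.Nat.Induction using (<-wellFounded)
import Data.Nat.Properties as ℕₚ
open import Data.Product using (Σ; ∃; ∃-syntax; _×_; _,_; proj₁; proj₂)
open import Data.Product.Properties using (≡-dec)
open import Data.Sum using (_⊎_; inj₁; inj₂; [_,_]′) renaming (swap to ⊎-swap)
import Data.Sum
open import Function using (_∘_; id)
open import Function.Bundles using (_⇔_; mk⇔; Equivalence)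
open import Function.Properties.Equivalence using () renaming (trans to ⇔-trans)
open import Induction.WellFounded using (Acc; acc)
open import Relation.Binary.Construct.Closure.ReflexiveTransitive using (Star; ε; _◅_; _◅◅_; reverse)
open import Relation.Binary.Definitions using (DecidableEquality)
open import Relation.Binary.PropositionalEquality
  using (_≡_; _≢_; refl; sym; trans; cong; cong₂; subst; subst₂; module ≡-Reasoning)
open import Relation.Binary.Structures using (IsTotalOrder)
open import Relation.Nullary using (¬_; Dec; yes; no; does; ¬?; _×-dec_)
open import Relation.Unary using (Pred; Decidable)
open import Relation.Unary.Properties using (∁?)

module _ {A : Set} where
  open import Data.Nat using (_+_; _≤_; _<_)
  open import Data.Nat.Properties using (≤-trans; ≤-reflexive; +-suc)

  length-≡-unique : {xs ys : List A} → Unique xs → Unique ys → (∀ {z} → z ∈ xs ⇔ z ∈ ys) →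
                    length xs ≡ length ys
  length-≡-unique xs! ys! xs⇔ys = ↭-length (∼bag⇒↭ (unique∧set⇒bag xs! ys! xs⇔ys))

  length-filter-cong : {P Q : Pred A 0ℓ} (P? : Decidable P) (Q? : Decidable Q) {xs ys : List A} →
                       Unique xs → Unique ys → (∀ {z} → (z ∈ xs × P z) ⇔ (z ∈ ys × Q z)) →
                       length (filter P? xs) ≡ length (filter Q? ys)
  length-filter-cong P? Q? xs! ys! xs⇔ys = length-≡-unique (Unique.filter⁺ P? xs!) (Unique.filter⁺ Q? ys!)
    (mk⇔ (λ z∈ → uncurry-filter⁺ Q? (Equivalence.to xs⇔ys (∈-filter⁻ P? z∈)))
         (λ z∈ → uncurry-filter⁺ P? (Equivalence.from xs⇔ys (∈-filter⁻ Q? z∈))))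
    where
    uncurry-filter⁺ : ∀ {R : Pred A _} (R? : Decidable R) {z zs} → z ∈ zs × R z → z ∈ filter R? zs
    uncurry-filter⁺ R? (z∈ , Rz) = ∈-filter⁺ R? z∈ Rz

  length-filter-∁ : {P : Pred A 0ℓ} (P? : Decidable P) (xs : List A) →
                    length (filter (∁? P?) xs) + length (filter P? xs) ≡ length xs
  length-filter-∁ P? [] = refl
  length-filter-∁ P? (x ∷ xs) with P? x
  ... | yes _ = trans (+-suc _ _) (cong suc (length-filter-∁ P? xs))
  ... | no  _ = cong suc (length-filter-∁ P? xs)

  lookup-injective : {xs : List A} → Unique xs → ∀ i j → lookup xs i ≡ lookup xs j → i ≡ j
  lookup-injective (_  ∷ _)   zero    zero    _  = refl
  lookup-injective (x∉ ∷ _)   zero    (suc j) eq = ⊥-elim (All.lookup x∉ (∈-lookup j) eq)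
  lookup-injective (x∉ ∷ _)   (suc i) zero    eq = ⊥-elim (All.lookup x∉ (∈-lookup i) (sym eq))
  lookup-injective (_  ∷ xs!) (suc i) (suc j) eq = cong suc (lookup-injective xs! i j eq)

  module _ (_≟_ : DecidableEquality A) where
    open import Data.List.Membership.DecPropositional _≟_ using (_∈?_)

    length-≤-unique : {xs ys : List A} → Unique xs → Unique ys → xs ⊆ ys → length xs ≤ length ys
    length-≤-unique {xs} {ys} xs! ys! xs⊆ys = ≤-trans
      (≤-reflexive (length-≡-unique xs! (Unique.filter⁺ (_∈? xs) {ys} ys!)
        (mk⇔ (λ z∈ → ∈-filter⁺ (_∈? xs) (xs⊆ys z∈) z∈)
             (λ z∈ → proj₂ (∈-filter⁻ (_∈? xs) {xs = ys} z∈)))))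
      (length-filter (_∈? xs) ys)

    length-filter-< : {P Q : Pred A 0ℓ} (P? : Decidable P) (Q? : Decidable Q) {xs : List A} → Unique xs →
                      (∀ {z} → P z → Q z) → ∀ {y} → y ∈ xs → Q y → ¬ P y →
                      length (filter P? xs) < length (filter Q? xs)
    length-filter-< P? Q? {xs} xs! P⇒Q {y} y∈xs Qy ¬Py =
      length-≤-unique (¬Any⇒All¬ (filter P? xs) y∉ ∷ Unique.filter⁺ P? xs!) (Unique.filter⁺ Q? xs!) sub
      where
      y∉ : y ∉ filter P? xs
      y∉ y∈ = ¬Py (proj₂ (∈-filter⁻ P? {xs = xs} y∈))
      sub : y ∷ filter P? xs ⊆ filter Q? xs
      sub (here refl) = ∈-filter⁺ Q? y∈xs Qy
      sub (there z∈)  = let z∈xs , Pz = ∈-filter⁻ P? {xs = xs} z∈ in ∈-filter⁺ Q? z∈xs (P⇒Q Pz)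

injective⇒surjective : ∀ {k} (f : Fin k → Fin k) → (∀ {i j} → f i ≡ f j → i ≡ j) → ∀ j → ∃[ i ] f i ≡ j
injective⇒surjective {suc k} f f-injective j with Finₚ.any? (λ i → f i Fin.≟ j)
... | yes hit  = hit
... | no  miss = ⊥-elim (ℕₚ.<-irrefl refl (Finₚ.injective⇒≤ squeeze-injective))
  where
  avoids : ∀ i → j ≢ f i
  avoids i j≡fi = miss (i , sym j≡fi)
  squeeze : Fin (suc k) → Fin k
  squeeze i = punchOut (avoids i)
  squeeze-injective : ∀ {i i′} → squeeze i ≡ squeeze i′ → i ≡ i′
  squeeze-injective {i} {i′} eq = f-injective (Finₚ.punchOut-injective (avoids i) (avoids i′) eq)

module TwoInvolutions
  {X : Set} (_≟_ : DecidableEquality X)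
  (universe : List X) (universe-unique : Unique universe) (∈-universe : ∀ x → x ∈ universe)
  (σ : Bool → X → X) (σ-involutive : ∀ d x → σ d (σ d x) ≡ x)
  (colour : X → Bool) (σ-fixes-or-flips : ∀ d x → σ d x ≡ x ⊎ colour (σ d x) ≡ not (colour x))
  where

  open import Data.List.Membership.DecPropositional _≟_ using (_∈?_)
  open import Data.Nat using (_+_; _*_; _≤_; _<_; s≤s; z≤n)
  open import Data.Nat.Properties
    using (+-commutativeSemigroup; <⇒≱; ≤-reflexive; +-suc; +-comm; +-identityʳ; +-cancelʳ-≡; m<m+n; 1+n≢n; m≢1+n+m)
  open import Data.Nat.Tactic.RingSolver using (solve)
  open import Algebra.Properties.CommutativeSemigroup +-commutativeSemigroup using (xy∙z≈xz∙y)
  open ≡-Reasoning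

  Step : X → X → Set
  Step x y = ∃[ d ] σ d x ≡ y

  Step-sym : ∀ {x y} → Step x y → Step y x
  Step-sym {x} (d , refl) = d , σ-involutive d x

  σ-injective : ∀ d {x y} → σ d x ≡ σ d y → x ≡ y
  σ-injective d {x} {y} eq = trans (sym (σ-involutive d x)) (trans (cong (σ d) eq) (σ-involutive d y))

  # : Bool → List X → ℕ
  # b xs = length (filter (λ x → colour x Bool.≟ b) xs)

  Balanced : List X → Set
  Balanced C = # true C ≡ # false C

  Surplus : Bool → List X → Set
  Surplus b C = # b C ≡ suc (# (not b) C)

  #-++ : ∀ b xs ys → # b (xs ++ ys) ≡ # b xs + # b ys
  #-++ b xs ys = trans (cong length (filter-++ _ xs ys)) (length-++ (filter _ xs))

  length≡#+# : ∀ b xs → length xs ≡ # b xs + # (not b) xs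
  length≡#+# b [] = refl
  length≡#+# b (x ∷ xs) with colour x | b
  ... | true  | true  = cong suc (length≡#+# true xs)
  ... | false | false = cong suc (length≡#+# false xs)
  ... | true  | false = trans (cong suc (length≡#+# false xs)) (sym (+-suc _ _))
  ... | false | true  = trans (cong suc (length≡#+# true xs)) (sym (+-suc _ _))

  surplus⇒odd : ∀ {b C} → Surplus b C → Odd (length C)
  surplus⇒odd {b} {C} surplus = # (not b) C , (begin
    length C                        ≡⟨ length≡#+# b C ⟩
    # b C + # (not b) C             ≡⟨ cong (_+ # (not b) C) surplus ⟩
    suc (# (not b) C + # (not b) C) ≡⟨ cong (λ t → suc (# (not b) C + t)) (+-identityʳ _) ⟨
    suc (2 * # (not b) C)           ∎)

  surplus⇒¬balanced : ∀ {b C} → Surplus b C → ¬ Balanced C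
  surplus⇒¬balanced {true}  surplus balanced = 1+n≢n (trans (sym surplus) balanced)
  surplus⇒¬balanced {false} surplus balanced = 1+n≢n (trans (sym surplus) (sym balanced))

  surplus⇒¬surplus-not : ∀ {b C} → Surplus b C → ¬ Surplus (not b) C
  surplus⇒¬surplus-not {true}  s s′ = m≢1+n+m _ (trans s (cong suc s′))
  surplus⇒¬surplus-not {false} s s′ = m≢1+n+m _ (trans s (cong suc s′))

  surplus-++ : ∀ b {C C′} → Surplus b C → Surplus (not b) C′ → Balanced (C ++ C′)
  surplus-++ b {C} {C′} s s′ = begin
    # true (C ++ C′)         ≡⟨ #-++ true C C′ ⟩
    # true C + # true C′     ≡⟨ counts b s s′ ⟩
    # false C + # false C′   ≡⟨ #-++ false C C′ ⟨
    # false (C ++ C′)        ∎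
    where
    counts : ∀ b → Surplus b C → Surplus (not b) C′ → # true C + # true C′ ≡ # false C + # false C′
    counts true  s s′ rewrite s | s′ = sym (+-suc _ _)
    counts false s s′ rewrite s | s′ = +-suc _ _

  #-cong : ∀ b {C C′} → Unique C → Unique C′ → (∀ {z} → z ∈ C ⇔ z ∈ C′) → # b C ≡ # b C′
  #-cong b C! C′! C⇔C′ = length-filter-cong _ _ C! C′!
    (mk⇔ (λ (z∈ , cz) → Equivalence.to C⇔C′ z∈ , cz) (λ (z∈ , cz) → Equivalence.from C⇔C′ z∈ , cz))

  Pending : Set₁
  Pending = X → Bool → Set

  nothing-pending : Pending
  nothing-pending _ _ = ⊥

  _∪⟨_,_⟩ : Pending → X → Bool → Pending
  (F ∪⟨ x , d ⟩) z d′ = F z d′ ⊎ (z ≡ x × d′ ≡ d)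

  -- F lists the pairs (z , d) for which σ d z may not have been visited yet.
  record Visited (r : X) (F : Pending) (V : List X) : Set where
    field
      unique : Unique V
      reach  : ∀ {z} → z ∈ V → Star Step r z
      closed : ∀ d {z} → z ∈ V → σ d z ∈ V ⊎ F z d

  walk : ℕ → Bool → X → List X → X × List X
  walk zero    d x V = x , V
  walk (suc f) d x V with σ d x ∈? V
  ... | yes _ = x , V
  ... | no  _ = walk f (not d) (σ d x) (σ d x ∷ V)

  -- The added segment alternates in colour from x to proj₁ result; alternates is its count.
  record Walked (r : X) (F : Pending) (x : X) (V : List X) (result : X × List X) : Set where
    field
      visited    : Visited r F (proj₂ result)
      segment    : List X
      decompose  : proj₂ result ≡ segment ++ V
      alternates : # true segment + # true [ x ] ≡ # false segment + # true [ proj₁ result ]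

  #-flip : ∀ {x y} → colour y ≡ not (colour x) → # false [ y ] ≡ # true [ x ]
  #-flip {x} {y} eq with colour x | colour y
  #-flip () | true  | true
  #-flip _  | true  | false = refl
  #-flip _  | false | true  = refl
  #-flip () | false | false

  direction-cases : ∀ d d′ → d′ ≡ d ⊎ d′ ≡ not d
  direction-cases true  true  = inj₁ refl
  direction-cases false false = inj₁ refl
  direction-cases true  false = inj₂ refl
  direction-cases false true  = inj₂ refl

  resolve : ∀ {r F x d V} → σ d x ∈ V → Visited r (F ∪⟨ x , d ⟩) V → Visited r F V
  resolve {r} {F} {x} {d} {V} σx∈V vis = record { unique = unique ; reach = reach ; closed = closed′ }
    where
    open Visited vis
    closed′ : ∀ d′ {z} → z ∈ V → σ d′ z ∈ V ⊎ F z d′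
    closed′ d′ z∈V with closed d′ z∈V
    ... | inj₁ σz∈V                 = inj₁ σz∈V
    ... | inj₂ (inj₁ pending)       = inj₂ pending
    ... | inj₂ (inj₂ (refl , refl)) = inj₁ σx∈V

  advance : ∀ {r F x d V} → Visited r (F ∪⟨ x , d ⟩) V → x ∈ V → σ d x ∉ V →
            Visited r (F ∪⟨ σ d x , not d ⟩) (σ d x ∷ V)
  advance {r} {F} {x} {d} {V} vis x∈V σx∉V =
    record { unique = ¬Any⇒All¬ V σx∉V ∷ unique ; reach = reach′ ; closed = closed′ }
    where
    open Visited vis
    reach′ : ∀ {z} → z ∈ σ d x ∷ V → Star Step r z
    reach′ (here refl) = reach x∈V ◅◅ ((d , refl) ◅ ε)
    reach′ (there z∈V) = reach z∈V
    closed′ : ∀ d′ {z} → z ∈ σ d x ∷ V → σ d′ z ∈ σ d x ∷ V ⊎ (F ∪⟨ σ d x , not d ⟩) z d′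
    closed′ d′ (here refl) with direction-cases d d′
    ... | inj₁ refl = inj₁ (there (subst (_∈ V) (sym (σ-involutive d x)) x∈V))
    ... | inj₂ refl = inj₂ (inj₂ (refl , refl))
    closed′ d′ (there z∈V) with closed d′ z∈V
    ... | inj₁ σz∈V                 = inj₁ (there σz∈V)
    ... | inj₂ (inj₁ pending)       = inj₂ (inj₁ pending)
    ... | inj₂ (inj₂ (refl , refl)) = inj₁ (here refl)

  prepend : ∀ {r F x d V result} → σ d x ≢ x → Walked r F (σ d x) (σ d x ∷ V) result → Walked r F x V result
  prepend {x = x} {d} {V} {x′ , V′} moved w = record
    { visited    = visited
    ; segment    = N ++ [ y ]
    ; decompose  = trans decompose (sym (++-assoc N [ y ] V))
    ; alternates = begin
        # true (N ++ [ y ]) + # true [ x ]        ≡⟨ cong (_+ # true [ x ]) (#-++ true N [ y ]) ⟩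
        # true N + # true [ y ] + # true [ x ]    ≡⟨ cong (_+ # true [ x ]) alternates ⟩
        # false N + # true [ x′ ] + # true [ x ]  ≡⟨ xy∙z≈xz∙y (# false N) _ _ ⟩
        # false N + # true [ x ] + # true [ x′ ]  ≡⟨ cong (λ t → # false N + t + # true [ x′ ]) (#-flip flips) ⟨
        # false N + # false [ y ] + # true [ x′ ] ≡⟨ cong (_+ # true [ x′ ]) (#-++ false N [ y ]) ⟨
        # false (N ++ [ y ]) + # true [ x′ ]     ∎
    }
    where
    open Walked w renaming (segment to N)
    y = σ d x
    flips : colour y ≡ not (colour x)
    flips with σ-fixes-or-flips d x
    ... | inj₁ fixed   = ⊥-elim (moved fixed)
    ... | inj₂ flipped = flipped

  walk-spec : ∀ {r F} f d x V → Visited r (F ∪⟨ x , d ⟩) V → x ∈ V → length universe < f + length V →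
              Walked r F x V (walk f d x V)
  walk-spec zero d x V vis x∈V fuel =
    ⊥-elim (<⇒≱ fuel (length-≤-unique _≟_ (Visited.unique vis) universe-unique (λ {z} _ → ∈-universe z)))
  walk-spec (suc f) d x V vis x∈V fuel with σ d x ∈? V
  ... | yes σx∈V = record { visited = resolve σx∈V vis ; segment = [] ; decompose = refl ; alternates = refl }
  ... | no  σx∉V = prepend (λ σx≡x → σx∉V (subst (_∈ V) (sym σx≡x) x∈V))
                     (walk-spec f (not d) (σ d x) (σ d x ∷ V) (advance vis x∈V σx∉V) (here refl)
                                (subst (length universe <_) (sym (+-suc f (length V))) fuel))

  walk-fixed : ∀ f d x V → σ d x ∈ V → proj₁ (walk f d x V) ≡ x
  walk-fixed zero    d x V _ = refl
  walk-fixed (suc f) d x V σx∈V with σ d x ∈? V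
  ... | yes _    = refl
  ... | no σx∉V = ⊥-elim (σx∉V σx∈V)

  -- x₁ and x₂ are the ends of C, read as a path from x₁ through the start to x₂.
  ends-shape : ∀ {C x₁ x₂} → # true C + 1 ≡ # false C + (# true [ x₁ ] + # true [ x₂ ]) →
               Balanced C ⊎ Surplus (colour x₁) C
  ends-shape {C} {x₁} {x₂} eq with colour x₁ | colour x₂
  ... | true  | true  = inj₂ (+-cancelʳ-≡ 1 _ _ (trans eq (+-suc _ 1)))
  ... | true  | false = inj₁ (+-cancelʳ-≡ 1 _ _ eq)
  ... | false | true  = inj₁ (+-cancelʳ-≡ 1 _ _ eq)
  ... | false | false = inj₂ (trans (sym (+-identityʳ _)) (trans (sym eq) (+-comm _ 1)))

  joined-segments : ∀ t₁ f₁ t₂ f₂ tr fr e₁ e₂ → tr + fr ≡ 1 → t₁ + tr ≡ f₁ + e₁ → t₂ + tr ≡ f₂ + e₂ →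
                    t₂ + (t₁ + tr) + 1 ≡ f₂ + (f₁ + fr) + (e₁ + e₂)
  joined-segments t₁ f₁ t₂ f₂ tr fr e₁ e₂ one seg₁ seg₂ = begin
    t₂ + (t₁ + tr) + 1           ≡⟨ cong (t₂ + (t₁ + tr) +_) one ⟨
    t₂ + (t₁ + tr) + (tr + fr)   ≡⟨ solve (t₁ ∷ t₂ ∷ tr ∷ fr ∷ []) ⟩
    (t₂ + tr) + (t₁ + tr) + fr   ≡⟨ cong₂ (λ u v → u + v + fr) seg₂ seg₁ ⟩
    (f₂ + e₂) + (f₁ + e₁) + fr   ≡⟨ solve (f₁ ∷ f₂ ∷ fr ∷ e₁ ∷ e₂ ∷ []) ⟩
    f₂ + (f₁ + fr) + (e₁ + e₂)   ∎

  two-walks-shape : ∀ {r F₁ F₂ x₁ V₁ x₂ V₂} → Walked r F₁ r [ r ] (x₁ , V₁) → Walked r F₂ r V₁ (x₂ , V₂) →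
                    Balanced V₂ ⊎ Surplus (colour x₁) V₂
  two-walks-shape {r} {x₁ = x₁} {V₁} {x₂} {V₂} w₁ w₂ = ends-shape {V₂} {x₁} {x₂} (begin
    # true V₂ + 1                                                              ≡⟨ cong (_+ 1) (split true) ⟩
    # true N₂ + (# true N₁ + # true [ r ]) + 1
      ≡⟨ joined-segments (# true N₁) (# false N₁) (# true N₂) (# false N₂) (# true [ r ]) (# false [ r ])
                         (# true [ x₁ ]) (# true [ x₂ ])
                         (sym (length≡#+# true [ r ])) (Walked.alternates w₁) (Walked.alternates w₂) ⟩
    # false N₂ + (# false N₁ + # false [ r ]) + (# true [ x₁ ] + # true [ x₂ ]) ≡⟨ cong (_+ _) (split false) ⟨
    # false V₂ + (# true [ x₁ ] + # true [ x₂ ])                                ∎)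
    where
    N₁ = Walked.segment w₁
    N₂ = Walked.segment w₂
    split : ∀ b → # b V₂ ≡ # b N₂ + (# b N₁ + # b [ r ])
    split b = begin
      # b V₂                        ≡⟨ cong (# b) (Walked.decompose w₂) ⟩
      # b (N₂ ++ V₁)                ≡⟨ #-++ b N₂ V₁ ⟩
      # b N₂ + # b V₁               ≡⟨ cong (λ V → # b N₂ + # b V) (Walked.decompose w₁) ⟩
      # b N₂ + # b (N₁ ++ [ r ])    ≡⟨ cong (# b N₂ +_) (#-++ b N₁ [ r ]) ⟩
      # b N₂ + (# b N₁ + # b [ r ]) ∎

  record Orbit (r : X) (C : List X) : Set where
    field
      unique    : Unique C
      r∈        : r ∈ C
      closed    : ∀ d {z} → z ∈ C → σ d z ∈ C
      reach     : ∀ {z} → z ∈ C → Star Step r z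
      end       : X
      end-fixed : σ true r ≡ r → end ≡ r
      shape     : Balanced C ⊎ Surplus (colour end) C

  orbit : ∀ r → ∃ (Orbit r)
  orbit r = V₂ , record
    { unique    = Visited.unique (Walked.visited w₂)
    ; r∈        = subst (r ∈_) (sym (Walked.decompose w₂)) (∈-++⁺ʳ (Walked.segment w₂) r∈V₁)
    ; closed    = closed
    ; reach     = Visited.reach (Walked.visited w₂)
    ; end       = x₁
    ; end-fixed = λ fixed → walk-fixed L true r [ r ] (subst (_∈ [ r ]) (sym fixed) (here refl))
    ; shape     = two-walks-shape w₁ w₂
    }
    where
    L = length universe

    start : Visited r ((nothing-pending ∪⟨ r , false ⟩) ∪⟨ r , true ⟩) [ r ]
    start = record { unique = [] ∷ [] ; reach = λ { (here refl) → ε } ; closed = both-pending }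
      where
      both-pending : ∀ d {z} → z ∈ [ r ] → σ d z ∈ [ r ] ⊎ ((nothing-pending ∪⟨ r , false ⟩) ∪⟨ r , true ⟩) z d
      both-pending true  (here refl) = inj₂ (inj₂ (refl , refl))
      both-pending false (here refl) = inj₂ (inj₁ (inj₂ (refl , refl)))

    x₁ = proj₁ (walk L true r [ r ])
    V₁ = proj₂ (walk L true r [ r ])
    w₁ : Walked r (nothing-pending ∪⟨ r , false ⟩) r [ r ] (x₁ , V₁)
    w₁ = walk-spec L true r [ r ] start (here refl) (m<m+n L (s≤s z≤n))

    r∈V₁ : r ∈ V₁
    r∈V₁ = subst (r ∈_) (sym (Walked.decompose w₁)) (∈-++⁺ʳ (Walked.segment w₁) (here refl))

    x₂ = proj₁ (walk L false r V₁)
    V₂ = proj₂ (walk L false r V₁)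
    w₂ : Walked r nothing-pending r V₁ (x₂ , V₂)
    w₂ = walk-spec L false r V₁ (Walked.visited w₁) r∈V₁ (m<m+n L (length-nonempty r∈V₁))
      where
      length-nonempty : ∀ {z zs} → z ∈ zs → 0 < length zs
      length-nonempty (here _)  = s≤s z≤n
      length-nonempty (there _) = s≤s z≤n

    closed : ∀ d {z} → z ∈ V₂ → σ d z ∈ V₂
    closed d z∈V₂ with Visited.closed (Walked.visited w₂) d z∈V₂
    ... | inj₁ σz∈V₂ = σz∈V₂

  orbit-from-fixed : ∀ {r C} → Orbit r C → σ true r ≡ r → Balanced C ⊎ Surplus (colour r) C
  orbit-from-fixed {C = C} orb fixed =
    subst (λ e → Balanced C ⊎ Surplus (colour e) C) (Orbit.end-fixed orb fixed) (Orbit.shape orb)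

  orbit-reach-closed : ∀ {r C} → Orbit r C → ∀ {x z} → x ∈ C → Star Step x z → z ∈ C
  orbit-reach-closed orb x∈C ε                    = x∈C
  orbit-reach-closed orb x∈C ((d , refl) ◅ steps) = orbit-reach-closed orb (Orbit.closed orb d x∈C) steps

  orbit-⊆ : ∀ {r r′ C C′} → Orbit r C → Orbit r′ C′ → ∀ {x} → x ∈ C → x ∈ C′ → C ⊆ C′
  orbit-⊆ orb orb′ x∈C x∈C′ z∈C =
    orbit-reach-closed orb′ x∈C′ (reverse Step-sym (Orbit.reach orb x∈C) ◅◅ Orbit.reach orb z∈C)

  module _ {r r′ C C′ x} (orb : Orbit r C) (orb′ : Orbit r′ C′) (x∈C : x ∈ C) (x∈C′ : x ∈ C′) where

    meeting-counts : ∀ b → # b C ≡ # b C′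
    meeting-counts b = #-cong b (Orbit.unique orb) (Orbit.unique orb′)
      (mk⇔ (orbit-⊆ orb orb′ x∈C x∈C′) (orbit-⊆ orb′ orb x∈C′ x∈C))

    meeting-balanced : ∀ {b} → Balanced C′ → ¬ Surplus b C
    meeting-balanced {b} balanced′ surplus = surplus⇒¬balanced {b} {C} surplus
      (trans (meeting-counts true) (trans balanced′ (sym (meeting-counts false))))

    meeting-surplus : ∀ {b} → Surplus (not b) C′ → ¬ Surplus b C
    meeting-surplus {b} surplus′ surplus = surplus⇒¬surplus-not {b} {C} surplus
      (trans (meeting-counts (not b)) (trans surplus′ (cong suc (sym (meeting-counts (not (not b)))))))

  unfixed⇒#≤# : ∀ d {r C b} → Orbit r C → (∀ {x} → x ∈ C → colour x ≡ b → σ d x ≢ x) → # b C ≤ # (not b) C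
  unfixed⇒#≤# d {C = C} {b} orb unfixed = subst (_≤ # (not b) C) (length-map (σ d) (filter B? C))
    (length-≤-unique _≟_ (Unique.map⁺ (σ-injective d) (Unique.filter⁺ B? (Orbit.unique orb)))
                         (Unique.filter⁺ NB? (Orbit.unique orb)) moved)
    where
    B?  = λ x → colour x Bool.≟ b
    NB? = λ x → colour x Bool.≟ not b
    moved : map (σ d) (filter B? C) ⊆ filter NB? C
    moved z∈ with ∈-map⁻ (σ d) z∈
    ... | x , x∈ , refl with ∈-filter⁻ B? {xs = C} x∈
    ...   | x∈C , cx with σ-fixes-or-flips d x
    ...     | inj₁ fixed   = ⊥-elim (unfixed x∈C cx fixed)
    ...     | inj₂ flipped = ∈-filter⁺ NB? (Orbit.closed orb d x∈C) (trans flipped (cong not cx))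

  surplus⇒fixed : ∀ d {r C b} → Orbit r C → Surplus b C → ∃[ x ] x ∈ C × colour x ≡ b × σ d x ≡ x
  surplus⇒fixed d {C = C} {b} orb surplus with any? (λ x → (colour x Bool.≟ b) ×-dec (σ d x ≟ x)) C
  ... | yes found = find found
  ... | no  none  = ⊥-elim (<⇒≱ (≤-reflexive (sym surplus))
                      (unfixed⇒#≤# d orb (λ x∈C cx fixed → none (lose x∈C (cx , fixed)))))

module _ {m n : ℕ} where

  _≟ₚ_ : DecidableEquality (Pos m n)
  _≟ₚ_ = ≡-dec Fin._≟_ Fin._≟_

  open import Data.List.Membership.DecPropositional _≟ₚ_ public using (_∈?_)

  allPos : List (Pos m n)
  allPos = cartesianProduct (allFin m) (allFin n)

  allPos-unique : Unique allPos
  allPos-unique = Unique.cartesianProduct⁺ (Unique.allFin⁺ m) (Unique.allFin⁺ n)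

  ∈-allPos : ∀ p → p ∈ allPos
  ∈-allPos (i , j) = ∈-cartesianProduct⁺ (∈-allFin i) (∈-allFin j)

  OnLine : Bool → Pos m n → Pos m n → Set
  OnLine true  p q = row p ≡ row q
  OnLine false p q = col p ≡ col q

  onLine? : ∀ d p q → Dec (OnLine d p q)
  onLine? true  p q = row p Fin.≟ row q
  onLine? false p q = col p Fin.≟ col q

  OnLine-sym : ∀ d {p q} → OnLine d p q → OnLine d q p
  OnLine-sym true  = sym
  OnLine-sym false = sym

  OnLine-trans : ∀ d {p q r} → OnLine d p q → OnLine d q r → OnLine d p r
  OnLine-trans true  = trans
  OnLine-trans false = trans

  OnLine⇒Adj : ∀ d {p q} → OnLine d p q → Adj p q
  OnLine⇒Adj true  = inj₁
  OnLine⇒Adj false = inj₂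

  Adj-sym : ∀ {p q : Pos m n} → Adj p q → Adj q p
  Adj-sym = Data.Sum.map sym sym

  Adj⇒OnLine : ∀ {p q} → Adj p q → ∃[ d ] OnLine d p q
  Adj⇒OnLine (inj₁ same-row) = true , same-row
  Adj⇒OnLine (inj₂ same-col) = false , same-col

  NoTwoOnALine : List (Pos m n) → Set
  NoTwoOnALine L = ∀ {p q} → p ∈ L → q ∈ L → Adj p q → p ≡ q

  fromList : (L : List (Pos m n)) → Unique L → NoTwoOnALine L → Assignment m n (length L)
  fromList L L! L-lines = record
    { pos    = lookup L
    ; rowInj = λ i j same-row → injective i j (inj₁ same-row)
    ; colInj = λ i j same-col → injective i j (inj₂ same-col)
    }
    where
    injective : ∀ i j → Adj (lookup L i) (lookup L j) → i ≡ j
    injective i j adj = lookup-injective L! i j (L-lines (∈-lookup i) (∈-lookup j) adj)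

  ∈-fromList : ∀ {L L!} {L-lines : NoTwoOnALine L} {p} → p ∈ₐ fromList L L! L-lines ⇔ p ∈ L
  ∈-fromList = mk⇔ (λ { (i , refl) → ∈-lookup i }) (λ p∈L → index p∈L , sym (lookup-index p∈L))

  ∈ₐ-subst : ∀ {k k′} (e : k ≡ k′) {α : Assignment m n k} {p} → p ∈ₐ subst (Assignment m n) e α ⇔ p ∈ₐ α
  ∈ₐ-subst refl = mk⇔ id id

module _ {m n k : ℕ} where
  open import Data.Nat using (_+_)

  toList : Assignment m n k → List (Pos m n)
  toList α = tabulate (pos α)

  toList-unique : ∀ (α : Assignment m n k) → Unique (toList α)
  toList-unique α = Unique.tabulate⁺ (λ {i} {j} eq → rowInj α i j (cong row eq))

  ∈-toList : ∀ {α : Assignment m n k} {p} → p ∈ toList α ⇔ p ∈ₐ α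
  ∈-toList {α} = mk⇔ (λ p∈ → let i , eq = ∈-tabulate⁻ p∈ in i , sym eq) (λ { (i , refl) → ∈-tabulate⁺ i })

  _∈ₐ?_ : ∀ p (α : Assignment m n k) → Dec (p ∈ₐ α)
  p ∈ₐ? α = Finₚ.any? (λ i → pos α i ≟ₚ p)

  onLine-injective : ∀ (α : Assignment m n k) d {p q} → p ∈ₐ α → q ∈ₐ α → OnLine d p q → p ≡ q
  onLine-injective α true  (i , refl) (j , refl) same-row = cong (pos α) (rowInj α i j same-row)
  onLine-injective α false (i , refl) (j , refl) same-col = cong (pos α) (colInj α i j same-col)

  Adj-injective : ∀ (α : Assignment m n k) {p q} → p ∈ₐ α → q ∈ₐ α → Adj p q → p ≡ q
  Adj-injective α p∈α q∈α adj = let d , line = Adj⇒OnLine adj in onLine-injective α d p∈α q∈α line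

  △-comm : ∀ {α β : Assignment m n k} {p} → p ∈△ α , β → p ∈△ β , α
  △-comm = ⊎-swap

  RowFree : Assignment m n k → Pos m n → Set
  RowFree α p = ∀ i → row (pos α i) ≢ row p

  -- Otherwise matching each position of α with the position of β in its row is an injection
  -- Fin k → Fin k that misses j₀.
  exclusiveRow-sym : ∀ (α β : Assignment m n k) → ∃[ j ] RowFree α (pos β j) → ∃[ i ] RowFree β (pos α i)
  exclusiveRow-sym α β (j₀ , j₀-free)
    with Finₚ.any? (λ i → Finₚ.all? (λ j → ¬? (row (pos β j) Fin.≟ row (pos α i))))
  ... | yes found = found
  ... | no  none  = let i , hits = injective⇒surjective partner partner-injective j₀ in
                    ⊥-elim (j₀-free i (sym (trans (cong (row ∘ pos β) (sym hits)) (shares-row i))))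
    where
    shared : ∀ i → ∃[ j ] row (pos β j) ≡ row (pos α i)
    shared i with Finₚ.any? (λ j → row (pos β j) Fin.≟ row (pos α i))
    ... | yes hit = hit
    ... | no  ¬hit = ⊥-elim (none (i , λ j same → ¬hit (j , same)))
    partner : Fin k → Fin k
    partner i = proj₁ (shared i)
    shares-row : ∀ i → row (pos β (partner i)) ≡ row (pos α i)
    shares-row i = proj₂ (shared i)
    partner-injective : ∀ {i i′} → partner i ≡ partner i′ → i ≡ i′
    partner-injective {i} {i′} eq =
      rowInj α i i′ (trans (sym (shares-row i)) (trans (cong (row ∘ pos β) eq) (shares-row i′)))

  record Exchangeable (α β : Assignment m n k) (D : List (Pos m n)) : Set where
    field
      closed   : ∀ {p q} → p ∈ D → q ∈△ α , β → Adj p q → q ∈ D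
      balanced : length (filter (_∈? D) (toList α)) ≡ length (filter (_∈? D) (toList β))

  Exchangeable-sym : ∀ {α β D} → Exchangeable α β D → Exchangeable β α D
  Exchangeable-sym {α} {β} ex = record
    { closed   = λ p∈D q∈△ → Exchangeable.closed ex p∈D (△-comm {β} {α} q∈△)
    ; balanced = sym (Exchangeable.balanced ex)
    }

  module Exchange {α β : Assignment m n k} {D : List (Pos m n)} (ex : Exchangeable α β D) where
    open Exchangeable ex

    kept : List (Pos m n)
    kept = filter (∁? (_∈? D)) (toList α)

    taken : List (Pos m n)
    taken = filter (_∈? D) (toList β)

    positions : List (Pos m n)
    positions = kept ++ taken

    ∈-positions : ∀ {p} → p ∈ positions ⇔ ((p ∈ₐ α × p ∉ D) ⊎ (p ∈ₐ β × p ∈ D))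
    ∈-positions = mk⇔ to from
      where
      to : ∀ {p} → p ∈ positions → (p ∈ₐ α × p ∉ D) ⊎ (p ∈ₐ β × p ∈ D)
      to p∈ with ∈-++⁻ kept p∈
      ... | inj₁ p∈kept  = let p∈α , p∉D = ∈-filter⁻ (∁? (_∈? D)) {xs = toList α} p∈kept in
                           inj₁ (Equivalence.to (∈-toList {α}) p∈α , p∉D)
      ... | inj₂ p∈taken = let p∈β , p∈D = ∈-filter⁻ (_∈? D) {xs = toList β} p∈taken in
                           inj₂ (Equivalence.to (∈-toList {β}) p∈β , p∈D)
      from : ∀ {p} → (p ∈ₐ α × p ∉ D) ⊎ (p ∈ₐ β × p ∈ D) → p ∈ positions
      from (inj₁ (p∈α , p∉D)) = ∈-++⁺ˡ (∈-filter⁺ (∁? (_∈? D)) (Equivalence.from (∈-toList {α}) p∈α) p∉D)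
      from (inj₂ (p∈β , p∈D)) = ∈-++⁺ʳ kept (∈-filter⁺ (_∈? D) (Equivalence.from (∈-toList {β}) p∈β) p∈D)

    positions-unique : Unique positions
    positions-unique = Unique.++⁺ (Unique.filter⁺ (∁? (_∈? D)) (toList-unique α)) (Unique.filter⁺ (_∈? D) (toList-unique β))
      (λ (p∈kept , p∈taken) → proj₂ (∈-filter⁻ (∁? (_∈? D)) {xs = toList α} p∈kept)
                                    (proj₂ (∈-filter⁻ (_∈? D) {xs = toList β} p∈taken)))

    boundary : ∀ {p q} → p ∈ₐ α → p ∉ D → q ∈ₐ β → q ∈ D → ¬ Adj q p
    boundary {p} p∈α p∉D q∈β q∈D adj with p ∈ₐ? β
    ... | yes p∈β = p∉D (subst (_∈ D) (Adj-injective β q∈β p∈β adj) q∈D)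
    ... | no  p∉β = p∉D (closed q∈D (inj₁ (p∈α , p∉β)) adj)

    positions-lines : NoTwoOnALine positions
    positions-lines p∈ q∈ adj with Equivalence.to ∈-positions p∈ | Equivalence.to ∈-positions q∈
    ... | inj₁ (p∈α , _)   | inj₁ (q∈α , _)   = Adj-injective α p∈α q∈α adj
    ... | inj₂ (p∈β , _)   | inj₂ (q∈β , _)   = Adj-injective β p∈β q∈β adj
    ... | inj₁ (p∈α , p∉D) | inj₂ (q∈β , q∈D) = ⊥-elim (boundary p∈α p∉D q∈β q∈D (Adj-sym adj))
    ... | inj₂ (p∈β , p∈D) | inj₁ (q∈α , q∉D) = ⊥-elim (boundary q∈α q∉D p∈β p∈D adj)

    length-positions : length positions ≡ k
    length-positions = begin
      length (kept ++ taken)                                        ≡⟨ length-++ kept ⟩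
      length kept + length taken                                    ≡⟨ cong (length kept +_) balanced ⟨
      length kept + length (filter (_∈? D) (toList α))              ≡⟨ length-filter-∁ (_∈? D) (toList α) ⟩
      length (toList α)                                             ≡⟨ length-tabulate (pos α) ⟩
      k                                                             ∎
      where open ≡-Reasoning

    assignment : Assignment m n k
    assignment = subst (Assignment m n) length-positions (fromList positions positions-unique positions-lines)

    ∈-assignment : ∀ {p} → p ∈ₐ assignment ⇔ ((p ∈ₐ α × p ∉ D) ⊎ (p ∈ₐ β × p ∈ D))
    ∈-assignment = ⇔-trans (∈ₐ-subst length-positions)
                           (⇔-trans (∈-fromList {L = positions} {L! = positions-unique} {L-lines = positions-lines}) ∈-positions)

    △-assignment : (∀ {p} → p ∈ D → p ∈△ α , β) → ∀ {p} → p ∈△ α , assignment ⇔ p ∈ D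
    △-assignment D⊆△ {p} = mk⇔ to from
      where
      to : p ∈△ α , assignment → p ∈ D
      to (inj₁ (p∈α , p∉γ)) with p ∈? D
      ... | yes p∈D = p∈D
      ... | no  p∉D = ⊥-elim (p∉γ (Equivalence.from ∈-assignment (inj₁ (p∈α , p∉D))))
      to (inj₂ (p∈γ , p∉α)) with Equivalence.to ∈-assignment p∈γ
      ... | inj₁ (p∈α , _) = ⊥-elim (p∉α p∈α)
      ... | inj₂ (_ , p∈D) = p∈D
      from : p ∈ D → p ∈△ α , assignment
      from p∈D with D⊆△ p∈D
      ... | inj₁ (p∈α , p∉β) = inj₁ (p∈α , λ p∈γ → excluded (Equivalence.to ∈-assignment p∈γ))
        where
        excluded : ¬ ((p ∈ₐ α × p ∉ D) ⊎ (p ∈ₐ β × p ∈ D))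
        excluded (inj₁ (_ , p∉D)) = p∉D p∈D
        excluded (inj₂ (p∈β , _)) = p∉β p∈β
      ... | inj₂ (p∈β , p∉α) = inj₂ (Equivalence.from ∈-assignment (inj₂ (p∈β , p∈D)) , p∉α)

    △-assignment-other : ∀ {p} → p ∈△ β , assignment → p ∈△ β , α × p ∉ D
    △-assignment-other {p} (inj₁ (p∈β , p∉γ)) with p ∈? D | p ∈ₐ? α
    ... | yes p∈D | _       = ⊥-elim (p∉γ (Equivalence.from ∈-assignment (inj₂ (p∈β , p∈D))))
    ... | no  p∉D | yes p∈α = ⊥-elim (p∉γ (Equivalence.from ∈-assignment (inj₁ (p∈α , p∉D))))
    ... | no  p∉D | no  p∉α = inj₁ (p∈β , p∉α) , p∉D
    △-assignment-other (inj₂ (p∈γ , p∉β)) with Equivalence.to ∈-assignment p∈γ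
    ... | inj₁ (p∈α , p∉D) = inj₂ (p∈α , p∉β) , p∉D
    ... | inj₂ (p∈β , _)   = ⊥-elim (p∉β p∈β)

  exchange : ∀ {α β D} → Exchangeable α β D → Assignment m n k
  exchange = Exchange.assignment

module CostProperties {c ℓ} (G : OrderedAbelianGroup c ℓ) where
  open OrderedAbelianGroup G
  open Costs G
  open IsAbelianGroup isAbelianGroup using (assoc; comm; identityˡ; identityʳ; inverseʳ; isCommutativeSemigroup)

  +-commutativeSemigroup : CommutativeSemigroup c c
  +-commutativeSemigroup = record { isCommutativeSemigroup = isCommutativeSemigroup }

  open import Algebra.Properties.CommutativeSemigroup +-commutativeSemigroup using (interchange; x∙yz≈y∙xz)
  open ≡-Reasoning

  +-cancelʳ-≤ : ∀ a b c → a + c ≤ b + c → a ≤ b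
  +-cancelʳ-≤ a b c a+c≤b+c = subst₂ _≤_ (undo a) (undo b) (+-monoˡ-≤ (a + c) (b + c) (- c) a+c≤b+c)
    where
    undo : ∀ x → x + c + - c ≡ x
    undo x = trans (assoc x c (- c)) (trans (cong (x +_) (inverseʳ c)) (identityʳ x))

  module _ {m n} (A : Fin m → Fin n → Carrier) where

    entry : Pos m n → Carrier
    entry p = A (row p) (col p)

    total : List (Pos m n) → Carrier
    total = foldr (λ p s → entry p + s) 0#

    total-++ : ∀ xs ys → total (xs ++ ys) ≡ total xs + total ys
    total-++ []       ys = sym (identityˡ _)
    total-++ (x ∷ xs) ys = trans (cong (entry x +_) (total-++ xs ys)) (sym (assoc _ _ _))

    total-filter-∁ : ∀ {P : Pred (Pos m n) 0ℓ} (P? : Decidable P) xs →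
                     total (filter (∁? P?) xs) + total (filter P? xs) ≡ total xs
    total-filter-∁ P? [] = identityʳ 0#
    total-filter-∁ P? (x ∷ xs) with P? x
    ... | yes _ = trans (x∙yz≈y∙xz _ _ _) (cong (entry x +_) (total-filter-∁ P? xs))
    ... | no  _ = trans (assoc _ _ _) (cong (entry x +_) (total-filter-∁ P? xs))

    cost-tabulate : ∀ {k} (f : Fin k → Pos m n) → sumFin (entry ∘ f) ≡ total (tabulate f)
    cost-tabulate {zero}  f = refl
    cost-tabulate {suc k} f = cong (entry (f zero) +_) (cost-tabulate (f ∘ suc))

    cost≡total : ∀ {k} (α : Assignment m n k) → cost A α ≡ total (toList α)
    cost≡total α = cost-tabulate (pos α)

    cost-subst : ∀ {k k′} (e : k ≡ k′) (α : Assignment m n k) → cost A (subst (Assignment m n) e α) ≡ cost A α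
    cost-subst refl α = refl

    cost-exchange : ∀ {k} {α β : Assignment m n k} {D} (ex : Exchangeable α β D) →
                    cost A (exchange ex) ≡ total (Exchange.positions ex)
    cost-exchange ex = begin
      cost A (exchange ex)                  ≡⟨ cost-subst length-positions listed ⟩
      cost A listed                       ≡⟨ cost≡total listed ⟩
      total (tabulate (lookup positions))   ≡⟨ cong total (tabulate-lookup positions) ⟩
      total positions                       ∎
      where
      open Exchange ex
      listed = fromList positions positions-unique positions-lines

    module _ {k} {α β : Assignment m n k} {D} (ex : Exchangeable α β D) where

      exchange-cost-sum : cost A (exchange ex) + cost A (exchange (Exchangeable-sym ex)) ≡ cost A α + cost A β
      exchange-cost-sum = begin
        cost A (exchange ex) + cost A (exchange (Exchangeable-sym ex))
          ≡⟨ cong₂ _+_ (trans (cost-exchange ex) (total-++ α∖D β∩D))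
                       (trans (cost-exchange (Exchangeable-sym ex)) (total-++ β∖D α∩D)) ⟩
        (total α∖D + total β∩D) + (total β∖D + total α∩D)   ≡⟨ cong ((total α∖D + total β∩D) +_) (comm _ _) ⟩
        (total α∖D + total β∩D) + (total α∩D + total β∖D)   ≡⟨ interchange _ _ _ _ ⟩
        (total α∖D + total α∩D) + (total β∩D + total β∖D)   ≡⟨ cong ((total α∖D + total α∩D) +_) (comm _ _) ⟩
        (total α∖D + total α∩D) + (total β∖D + total β∩D)
          ≡⟨ cong₂ _+_ (total-filter-∁ (_∈? D) (toList α)) (total-filter-∁ (_∈? D) (toList β)) ⟩
        total (toList α) + total (toList β)                 ≡⟨ cong₂ _+_ (cost≡total α) (cost≡total β) ⟨
        cost A α + cost A β                                 ∎
        where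
        α∖D = filter (∁? (_∈? D)) (toList α)
        α∩D = filter (_∈? D) (toList α)
        β∖D = filter (∁? (_∈? D)) (toList β)
        β∩D = filter (_∈? D) (toList β)

      exchange-optimal : Optimal A α → Optimal A β → Optimal A (exchange ex)
      exchange-optimal α-optimal β-optimal ρ =
        ≤-trans (+-cancelʳ-≤ (cost A γ) (cost A β) (cost A γ′) bound) (β-optimal ρ)
        where
        ≤-trans = IsTotalOrder.trans isTotalOrder
        γ  = exchange ex
        γ′ = exchange (Exchangeable-sym ex)
        bound : cost A γ + cost A γ′ ≤ cost A β + cost A γ′
        bound = subst₂ _≤_ (sym exchange-cost-sum) (comm _ _) (+-monoˡ-≤ _ _ (cost A β) (α-optimal γ′))

module SymDiff {m n k : ℕ} (μ ν : Assignment m n k) where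

  S : Pos m n → Set
  S p = p ∈△ μ , ν

  S? : Decidable S
  S? p with p ∈ₐ? μ | p ∈ₐ? ν
  ... | yes p∈μ | yes p∈ν = no λ { (inj₁ (_ , p∉ν)) → p∉ν p∈ν ; (inj₂ (_ , p∉μ)) → p∉μ p∈μ }
  ... | yes p∈μ | no  p∉ν = yes (inj₁ (p∈μ , p∉ν))
  ... | no  p∉μ | yes p∈ν = yes (inj₂ (p∈ν , p∉μ))
  ... | no  p∉μ | no  p∉ν = no λ { (inj₁ (p∈μ , _)) → p∉μ p∈μ ; (inj₂ (p∈ν , _)) → p∉ν p∈ν }

  side : Bool → Assignment m n k
  side true  = μ
  side false = ν

  colour : Pos m n → Bool
  colour p = does (p ∈ₐ? μ)

  ∈-side : ∀ {p} → S p → p ∈ₐ side (colour p)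
  ∈-side {p} Sp with p ∈ₐ? μ | Sp
  ... | yes p∈μ | _              = p∈μ
  ... | no  p∉μ | inj₁ (p∈μ , _) = ⊥-elim (p∉μ p∈μ)
  ... | no  p∉μ | inj₂ (p∈ν , _) = p∈ν

  ∉-side-not : ∀ {p} → S p → ¬ p ∈ₐ side (not (colour p))
  ∉-side-not {p} Sp with p ∈ₐ? μ | Sp
  ... | yes _   | inj₁ (_ , p∉ν) = p∉ν
  ... | yes p∈μ | inj₂ (_ , p∉μ) = ⊥-elim (p∉μ p∈μ)
  ... | no  p∉μ | _              = p∉μ

  side-colour : ∀ b {p} → S p → p ∈ₐ side b → colour p ≡ b
  side-colour b {p} Sp p∈side with colour p Bool.≟ b
  ... | yes same   = same
  ... | no  differ = ⊥-elim (∉-side-not Sp (subst (λ c → p ∈ₐ side c) b≡ p∈side))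
    where
    b≡ : b ≡ not (colour p)
    b≡ = sym (trans (cong not (¬-not differ)) (not-involutive b))

  side⇒S : ∀ c {p} → p ∈ₐ side (not c) → ¬ p ∈ₐ side c → S p
  side⇒S true  p∈ν p∉μ = inj₂ (p∈ν , p∉μ)
  side⇒S false p∈μ p∉ν = inj₁ (p∈μ , p∉ν)

  Partner : Bool → Pos m n → Pos m n → Set
  Partner d x y = S x × S y × x ≢ y × OnLine d x y

  partner? : ∀ d x y → Dec (Partner d x y)
  partner? d x y = S? x ×-dec S? y ×-dec ¬? (x ≟ₚ y) ×-dec onLine? d x y

  partner-sym : ∀ {d x y} → Partner d x y → Partner d y x
  partner-sym {d} (Sx , Sy , x≢y , line) = Sy , Sx , x≢y ∘ sym , OnLine-sym d line

  partner-flips : ∀ {d x y} → Partner d x y → colour y ≡ not (colour x)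
  partner-flips {d} {x} {y} (Sx , Sy , x≢y , line) with colour x Bool.≟ colour y
  ... | no  differ = ¬-not (differ ∘ sym)
  ... | yes same   = ⊥-elim (x≢y (onLine-injective (side (colour x)) d (∈-side Sx)
                                     (subst (λ c → y ∈ₐ side c) (sym same) (∈-side Sy)) line))

  partner-unique : ∀ {d x y z} → Partner d x y → Partner d x z → y ≡ z
  partner-unique {d} {x} {y} {z} x~y@(_ , Sy , _ , xy-line) x~z@(_ , Sz , _ , xz-line) =
    onLine-injective (side (colour y)) d (∈-side Sy)
      (subst (λ c → z ∈ₐ side c) (trans (partner-flips x~z) (sym (partner-flips x~y))) (∈-side Sz))
      (OnLine-trans d (OnLine-sym d xy-line) xz-line)

  mate : Bool → Pos m n → Pos m n
  mate d x with any? (partner? d x) allPos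
  ... | yes found = proj₁ (satisfied found)
  ... | no  _     = x

  mate-spec : ∀ d x → Partner d x (mate d x) ⊎ (mate d x ≡ x × ∀ y → ¬ Partner d x y)
  mate-spec d x with any? (partner? d x) allPos
  ... | yes found = inj₁ (proj₂ (satisfied found))
  ... | no  none  = inj₂ (refl , λ y x~y → none (lose (∈-allPos y) x~y))

  mate-partner : ∀ {d x y} → Partner d x y → mate d x ≡ y
  mate-partner {d} {x} x~y with mate-spec d x
  ... | inj₁ x~mate      = partner-unique x~mate x~y
  ... | inj₂ (_ , alone) = ⊥-elim (alone _ x~y)

  mate-involutive : ∀ d x → mate d (mate d x) ≡ x
  mate-involutive d x with mate-spec d x
  ... | inj₁ x~mate      = mate-partner (partner-sym x~mate)
  ... | inj₂ (fixed , _) = trans (cong (mate d) fixed) fixed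

  mate-fixes-or-flips : ∀ d x → mate d x ≡ x ⊎ colour (mate d x) ≡ not (colour x)
  mate-fixes-or-flips d x with mate-spec d x
  ... | inj₁ x~mate      = inj₂ (partner-flips x~mate)
  ... | inj₂ (fixed , _) = inj₁ fixed

  open TwoInvolutions _≟ₚ_ allPos allPos-unique ∈-allPos mate mate-involutive colour mate-fixes-or-flips public

  mate-S : ∀ d {x} → S x → S (mate d x)
  mate-S d {x} Sx with mate-spec d x
  ... | inj₁ (_ , S-mate , _) = S-mate
  ... | inj₂ (fixed , _)      = subst S (sym fixed) Sx

  module _ {r C} (orb : Orbit r C) (Sr : S r) where
    open Orbit orb

    orbit-⊆S : ∀ {z} → z ∈ C → S z
    orbit-⊆S z∈C = along Sr (reach z∈C)
      where
      along : ∀ {x z} → S x → Star Step x z → S z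
      along Sx ε                    = Sx
      along Sx ((d , refl) ◅ steps) = along (mate-S d Sx) steps

    orbit-Adj-closed : ∀ {x z} → x ∈ C → S z → Adj x z → z ∈ C
    orbit-Adj-closed {x} {z} x∈C Sz adj with z ≟ₚ x
    ... | yes refl = x∈C
    ... | no  z≢x  = let d , line = Adj⇒OnLine adj in
                     subst (_∈ C) (mate-partner (orbit-⊆S x∈C , Sz , z≢x ∘ sym , line)) (closed d x∈C)

    orbit-component : (S′ : Pos m n → Set) → (∀ {p} → S′ p → S p) → (∀ {p} → p ∈ C → S′ p) → IsComponent S′ C
    orbit-component S′ S′⊆S C⊆S′ =
      unique , r , λ q → (λ q∈C → C⊆S′ r∈ , steps⇒Reach r∈ (reach q∈C)) , (λ (_ , path) → Reach⇒∈ r∈ path)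
      where
      steps⇒Reach : ∀ {x z} → x ∈ C → Star Step x z → Reach S′ x z
      steps⇒Reach x∈C ε = ε
      steps⇒Reach {x} x∈C ((d , refl) ◅ steps) with mate-spec d x
      ... | inj₁ (_ , _ , _ , line) =
        (C⊆S′ x∈C , C⊆S′ (closed d x∈C) , OnLine⇒Adj d line) ◅ steps⇒Reach (closed d x∈C) steps
      ... | inj₂ (fixed , _)        = subst (λ w → Reach S′ w _) fixed (steps⇒Reach (closed d x∈C) steps)
      Reach⇒∈ : ∀ {x z} → x ∈ C → Reach S′ x z → z ∈ C
      Reach⇒∈ x∈C ε                        = x∈C
      Reach⇒∈ x∈C ((_ , S′y , adj) ◅ path) = Reach⇒∈ (orbit-Adj-closed x∈C (S′⊆S S′y) adj) path

  #≡count-side : ∀ b {D} → Unique D → (∀ {p} → p ∈ D → S p) → # b D ≡ length (filter (_∈? D) (toList (side b)))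
  #≡count-side b {D} D! D⊆S = length-filter-cong _ _ D! (toList-unique (side b)) (mk⇔ to from)
    where
    to : ∀ {z} → z ∈ D × colour z ≡ b → z ∈ toList (side b) × z ∈ D
    to (z∈D , refl) = Equivalence.from (∈-toList {α = side b}) (∈-side (D⊆S z∈D)) , z∈D
    from : ∀ {z} → z ∈ toList (side b) × z ∈ D → z ∈ D × colour z ≡ b
    from (z∈side , z∈D) = z∈D , side-colour b (D⊆S z∈D) (Equivalence.to (∈-toList {α = side b}) z∈side)

  exchangeable : ∀ {D} → Unique D → (∀ {p} → p ∈ D → S p) → (∀ {p q} → p ∈ D → S q → Adj p q → q ∈ D) →
                 Balanced D → Exchangeable μ ν D
  exchangeable D! D⊆S D-closed balanced = record
    { closed   = D-closed
    ; balanced = trans (sym (#≡count-side true D! D⊆S)) (trans balanced (#≡count-side false D! D⊆S))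
    }

  fixed⇒rowFree : ∀ {x} → S x → mate true x ≡ x → RowFree (side (not (colour x))) x
  fixed⇒rowFree {x} Sx x-fixed i same-row =
    w≢x (trans (sym (mate-partner (Sx , Sw , w≢x ∘ sym , sym same-row))) x-fixed)
    where
    w = pos (side (not (colour x))) i
    w≢x : w ≢ x
    w≢x w≡x = ∉-side-not Sx (i , w≡x)
    Sw : S w
    Sw = side⇒S (colour x) (i , refl)
           (λ w∈side → w≢x (onLine-injective (side (colour x)) true w∈side (∈-side Sx) same-row))

  rowFree⇒fixed : ∀ c {y} → S y → colour y ≡ not c → RowFree (side c) y → mate true y ≡ y
  rowFree⇒fixed c {y} Sy y-colour y-free with mate-spec true y
  ... | inj₂ (fixed , _) = fixed
  ... | inj₁ y~w@(_ , Sw , _ , same-row) =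
    let i , eq = subst (λ b → mate true y ∈ₐ side b) w-colour (∈-side Sw) in
    ⊥-elim (y-free i (trans (cong row eq) (sym same-row)))
    where
    w-colour : colour (mate true y) ≡ c
    w-colour = trans (partner-flips {true} {y} y~w) (trans (cong not y-colour) (not-involutive c))

  opposite-fixed : ∀ {x} → S x → mate true x ≡ x → ∃[ y ] S y × colour y ≡ not (colour x) × mate true y ≡ y
  opposite-fixed {x} Sx x-fixed = y , Sy , y-colour , rowFree⇒fixed c Sy y-colour y-free
    where
    c = colour x
    found = exclusiveRow-sym (side (not c)) (side c)
              (let j , eq = ∈-side Sx in j , subst (RowFree (side (not c))) (sym eq) (fixed⇒rowFree Sx x-fixed))
    i = proj₁ found
    y = pos (side (not c)) i
    y-free : RowFree (side c) y
    y-free = proj₂ found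
    Sy : S y
    Sy = side⇒S c (i , refl) (λ (i′ , eq) → y-free i′ (cong row eq))
    y-colour : colour y ≡ not c
    y-colour = side-colour (not c) Sy (i , refl)

symDiffSize : ∀ {m n k} → Assignment m n k → Assignment m n k → ℕ
symDiffSize μ ν = length (filter (SymDiff.S? μ ν) allPos)

module Descent {c ℓ} (G : OrderedAbelianGroup c ℓ) {m n k : ℕ} (A : Fin m → Fin n → OrderedAbelianGroup.Carrier G)
               (μ : Assignment m n k) (μ-optimal : Costs.Optimal G A μ) (a : Pos m n) (a∉μ : ¬ a ∈ₐ μ) where
  open import Data.Nat using (_<_)
  open Costs G using (Optimal)
  open CostProperties G using (exchange-optimal)

  Goal : Set ℓ
  Goal = Σ (Assignment m n k) (λ ν′ → Optimal A ν′ × a ∈ₐ ν′ ×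
           (OnePath (λ p → p ∈△ μ , ν′) ⊎ TwoOddPaths (λ p → p ∈△ μ , ν′)))

  module Round (ν : Assignment m n k) (ν-optimal : Optimal A ν) (a∈ν : a ∈ₐ ν)
              (recurse : ∀ ν₂ → symDiffSize μ ν₂ < symDiffSize μ ν → Optimal A ν₂ → a ∈ₐ ν₂ → Goal) where
    open SymDiff μ ν

    Sa : S a
    Sa = inj₂ (a∈ν , a∉μ)

    P : List (Pos m n)
    P = proj₁ (orbit a)

    P-orbit : Orbit a P
    P-orbit = proj₂ (orbit a)

    record Exchanged (D : List (Pos m n)) : Set ℓ where
      field
        ν′        : Assignment m n k
        optimal   : Optimal A ν′
        a∈ν′      : a ∈ₐ ν′
        covered   : ∀ {p} → p ∈△ μ , ν′ → p ∈ D
        component : ∀ {r C} → Orbit r C → S r → (∀ {p} → p ∈ C → p ∈ D) → IsComponent (λ p → p ∈△ μ , ν′) C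

    exchange-along : ∀ D → Unique D → (∀ {p} → p ∈ D → S p) → (∀ {p q} → p ∈ D → S q → Adj p q → q ∈ D) →
                     Balanced D → a ∈ D → Exchanged D
    exchange-along D D! D⊆S D-closed balanced a∈D = record
      { ν′        = exchange ex
      ; optimal   = exchange-optimal A ex μ-optimal ν-optimal
      ; a∈ν′      = Equivalence.from (Exchange.∈-assignment ex) (inj₂ (a∈ν , a∈D))
      ; covered   = Equivalence.to △⇔D
      ; component = λ orb Sr C⊆D →
                      orbit-component orb Sr _ (D⊆S ∘ Equivalence.to △⇔D) (Equivalence.from △⇔D ∘ C⊆D)
      }
      where
      ex = exchangeable D! D⊆S D-closed balanced
      △⇔D = Exchange.△-assignment ex D⊆S

    one-path : Balanced P → Goal
    one-path balanced = ν′ , optimal , a∈ν′ , inj₁ (P , component P-orbit Sa (λ p∈P → p∈P) , λ _ → covered)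
      where
      open Exchanged (exchange-along P (Orbit.unique P-orbit) (orbit-⊆S P-orbit Sa) (orbit-Adj-closed P-orbit Sa)
                                     balanced (Orbit.r∈ P-orbit))

    two-paths : ∀ {b y Q} → Orbit y Q → S y → Surplus b P → Surplus (not b) Q → Goal
    two-paths {b} {y} {Q} Q-orbit Sy P-surplus Q-surplus =
      ν′ , optimal , a∈ν′ ,
      inj₂ (P , Q , component P-orbit Sa ∈-++⁺ˡ , component Q-orbit Sy (∈-++⁺ʳ P) , (λ _ → disjoint) ,
            (λ _ → ∈-++⁻ P ∘ covered) , surplus⇒odd {b} {P} P-surplus , surplus⇒odd {not b} {Q} Q-surplus)
      where
      disjoint : ∀ {z} → z ∈ P → z ∈ Q → ⊥
      disjoint z∈P z∈Q = meeting-surplus P-orbit Q-orbit z∈P z∈Q {b} Q-surplus P-surplus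
      D! : Unique (P ++ Q)
      D! = Unique.++⁺ (Orbit.unique P-orbit) (Orbit.unique Q-orbit) (λ (z∈P , z∈Q) → disjoint z∈P z∈Q)
      D⊆S : ∀ {p} → p ∈ P ++ Q → S p
      D⊆S p∈D = [ orbit-⊆S P-orbit Sa , orbit-⊆S Q-orbit Sy ]′ (∈-++⁻ P p∈D)
      D-closed : ∀ {p q} → p ∈ P ++ Q → S q → Adj p q → q ∈ P ++ Q
      D-closed p∈D Sq adj with ∈-++⁻ P p∈D
      ... | inj₁ p∈P = ∈-++⁺ˡ (orbit-Adj-closed P-orbit Sa p∈P Sq adj)
      ... | inj₂ p∈Q = ∈-++⁺ʳ P (orbit-Adj-closed Q-orbit Sy p∈Q Sq adj)
      open Exchanged (exchange-along (P ++ Q) D! D⊆S D-closed (surplus-++ b {P} {Q} P-surplus Q-surplus)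
                                     (∈-++⁺ˡ (Orbit.r∈ P-orbit)))

    shrink : ∀ {y Q} → Orbit y Q → S y → Balanced Q → a ∉ Q → Goal
    shrink {y} {Q} Q-orbit Sy balanced a∉Q = recurse ν₂ smaller (exchange-optimal A ex ν-optimal μ-optimal) a∈ν₂
      where
      ex : Exchangeable ν μ Q
      ex = Exchangeable-sym (exchangeable (Orbit.unique Q-orbit) (orbit-⊆S Q-orbit Sy) (orbit-Adj-closed Q-orbit Sy) balanced)
      ν₂ = exchange ex
      a∈ν₂ : a ∈ₐ ν₂
      a∈ν₂ = Equivalence.from (Exchange.∈-assignment ex) (inj₁ (a∈ν , a∉Q))
      smaller : symDiffSize μ ν₂ < symDiffSize μ ν
      smaller = length-filter-< _≟ₚ_ (SymDiff.S? μ ν₂) S? allPos-unique (proj₁ ∘ Exchange.△-assignment-other ex)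
                  (∈-allPos y) Sy (λ Sy₂ → proj₂ (Exchange.△-assignment-other ex Sy₂) (Orbit.r∈ Q-orbit))

    second-orbit : ∀ {b y Q} → Surplus b P → Orbit y Q → S y → colour y ≡ not b → mate true y ≡ y → Goal
    second-orbit {b} {y} {Q} P-surplus Q-orbit Sy y-colour y-fixed with orbit-from-fixed Q-orbit y-fixed
    ... | inj₁ Q-balanced = shrink Q-orbit Sy Q-balanced
                              (λ a∈Q → meeting-balanced P-orbit Q-orbit (Orbit.r∈ P-orbit) a∈Q {b} Q-balanced P-surplus)
    ... | inj₂ Q-surplus  = two-paths Q-orbit Sy P-surplus (subst (λ c → Surplus c Q) y-colour Q-surplus)

    unbalanced : ∀ {b} → Surplus b P → Goal
    unbalanced {b} P-surplus =
      let x , x∈P , x-colour , x-fixed = surplus⇒fixed true {b = b} P-orbit P-surplus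
          y , Sy , y-colour , y-fixed = opposite-fixed (orbit-⊆S P-orbit Sa x∈P) x-fixed
      in second-orbit P-surplus (proj₂ (orbit y)) Sy (trans y-colour (cong not x-colour)) y-fixed

    conclusion : Goal
    conclusion = [ one-path , unbalanced ]′ (Orbit.shape P-orbit)

  descend : ∀ ν → Acc _<_ (symDiffSize μ ν) → Optimal A ν → a ∈ₐ ν → Goal
  descend ν (acc smaller) ν-optimal a∈ν = Round.conclusion ν ν-optimal a∈ν (λ ν₂ lt → descend ν₂ (smaller lt))

lemma3p1 : ∀ {c ℓ} (G : OrderedAbelianGroup c ℓ) (m n k : ℕ) →
    (A : Fin m → Fin n → OrderedAbelianGroup.Carrier G) → NonNeg G A → k ≤ℕ m ⊓ n →
    (μ : Assignment m n k) → Costs.Optimal G A μ →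
    (a : Pos m n) → ¬ (a ∈ₐ μ) →
    (ν : Assignment m n k) → Costs.Optimal G A ν → a ∈ₐ ν →
    Σ (Assignment m n k) (λ ν′ → Costs.Optimal G A ν′ × a ∈ₐ ν′ ×
      (OnePath (λ p → p ∈△ μ , ν′) ⊎ TwoOddPaths (λ p → p ∈△ μ , ν′)))
lemma3p1 G m n k A _ _ μ μ-optimal a a∉μ ν ν-optimal a∈ν =
  Descent.descend G A μ μ-optimal a a∉μ ν (<-wellFounded _) ν-optimal a∈ν
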